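{- For every type $A$, $[\![A]\!]\subseteq\mathsf{SN}$.
   Context: Polymorphic System I. Types: $A ::= X \mid A\Rightarrow A \mid A\wedge A \mid \forall X.A$ ($FTV$ free type variables, modulo $\alpha$). Type isomorphism $\equiv$: smallest congruence containing $A\wedge B\equiv B\wedge A$; $A\wedge(B\wedge C)\equiv(A\wedge B)\wedge C$; $A\Rightarrow(B\wedge C)\equiv(A\Rightarrow B)\wedge(A\Rightarrow C)$; $(A\wedge B)\Rightarrow C\equiv A\Rightarrow B\Rightarrow C$; $\forall X.(A\Rightarrow B)\equiv A\Rightarrow\forall X.B$ if $X\notin FTV(A)$; $\forall X.(A\wedge B)\equiv\forall X.A\wedge\forall X.B$. Terms: $r ::= x^A \mid \lambda x^A.r \mid rr \mid \langle r,r\rangle \mid \pi_A(r) \mid \Lambda X.r \mid r[A]$, typed by: $\Gamma,x:A\vdash x:A$; from $\Gamma\vdash r:A$, $A\equiv B$ infer $\Gamma\vdash r:B$; from $\Gamma,x:A\vdash r:B$ infer $\Gamma\vdash\lambda x^A.r:A\Rightarrow B$; from $\Gamma\vdash r:A\Rightarrow B$, $\Gamma\vdash s:A$ infer $\Gamma\vdash rs:B$; from $\Gamma\vdash r:A$, $\Gamma\vdash s:B$ infer $\Gamma\vdash\langle r,s\rangle:A\wedge B$; from $\Gamma\vdash r:A\wedge B$ infer $\Gamma\vdash\pi_A(r):A$; from $\Gamma\vdash r:A$, $X\notin FTV(\Gamma)$ infer $\Gamma\vdash\Lambda X.r:\forall X.A$; from $\Gamma\vdash r:\forall X.A$ infer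 $\Gamma\vdash r[B]:[X:=B]A$. Term equivalence $\rightleftarrows$: symmetric, closed under term constructors, generated by $\langle r,s\rangle\rightleftarrows\langle s,r\rangle$; $\langle r,\langle s,t\rangle\rangle\rightleftarrows\langle\langle r,s\rangle,t\rangle$; $\lambda x^A.\langle r,s\rangle\rightleftarrows\langle\lambda x^A.r,\lambda x^A.s\rangle$; $\langle r,s\rangle t\rightleftarrows\langle rt,st\rangle$; $r\langle s,t\rangle\rightleftarrows (rs)t$; $\Lambda X.\lambda x^A.r\rightleftarrows\lambda x^A.\Lambda X.r$ if $X\notin FTV(A)$; $(\lambda x^A.r)[B]\rightleftarrows\lambda x^A.(r[B])$; $\Lambda X.\langle r,s\rangle\rightleftarrows\langle\Lambda X.r,\Lambda X.s\rangle$; $\langle r,s\rangle[A]\rightleftarrows\langle r[A],s[A]\rangle$; $\pi_{\forall X.A}(\Lambda X.r)\rightleftarrows\Lambda X.\pi_A(r)$; $(\pi_{\forall X.B}(r))[A]\rightleftarrows\pi_{[X:=A]B}(r[A])$ if $r$ has type $\forall X.(B\wedge C)$. Reduction $\hookrightarrow$: closure under term constructors of $(\lambda x^A.r)s\hookrightarrow[x:=s]r$ if $s$ has type $A$; $(\Lambda X.r)[A]\hookrightarrow[X:=A]r$; $\pi_A(\langle r,s\rangle)\hookrightarrow r$ if $r$ has type $A$. $\to\ :=\ \rightleftarrows^*\circ\hookrightarrow\circ\rightleftarrows^*$; $\mathsf{SN}$ is the set of typed terms strongly normalising for $\to$. Elimination contexts (hole $[\cdot]_A$ of type $A$): $[\cdot]_A$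 has type $A$; if $K$ has type $B\Rightarrow C$ and $s\in\mathsf{SN}$ has type $B$, then $Ks$ has type $C$; if $K$ has type $B\wedge C$ then $\pi_B(K)$ has type $B$; if $K$ has type $\forall X.B$ then $K[C]$ has type $[X:=C]B$. $K[t]$ is $K$ with its hole replaced by $t$. $\mathcal T(K)$: $\mathcal T([\cdot]_A)=\emptyset$, $\mathcal T(Ks)=\mathcal T(K)\uplus\{s\}$, $\mathcal T(\pi_B(K))=\mathcal T(K[C])=\mathcal T(K)$. $[\![A]\!]$ is the set of terms $r$ of type $A$ such that for every elimination context $K$ with hole of type $A$, whose type is a type variable, with all terms of $\mathcal T(K)$ in $\mathsf{SN}$, we have $K[r]\in\mathsf{SN}$. -}

module Defs where

open import Data.Nat using (ℕ; zero; suc)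
open import Data.List using (List; []; _∷_; map; _++_)
open import Data.Product using (Σ; _×_; ∃-syntax)
open import Relation.Binary.PropositionalEquality using (_≡_)
open import Relation.Binary.Construct.Closure.ReflexiveTransitive using (Star)
open import Induction.WellFounded using (Acc)

-- Types (type variables as de Bruijn indices: types are modulo α)

infixr 7 _⇒_
infixr 8 _∧_

data Ty : Set where
  tv  : ℕ → Ty
  _⇒_ : Ty → Ty → Ty
  _∧_ : Ty → Ty → Ty
  ∀'  : Ty → Ty          -- ∀X.A, X is index 0 in the body

extR : (ℕ → ℕ) → ℕ → ℕ
extR ρ zero    = zero
extR ρ (suc n) = suc (ρ n)

renT : (ℕ → ℕ) → Ty → Ty
renT ρ (tv n)  = tv (ρ n)
renT ρ (A ⇒ B) = renT ρ A ⇒ renT ρ B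
renT ρ (A ∧ B) = renT ρ A ∧ renT ρ B
renT ρ (∀' A)  = ∀' (renT (extR ρ) A)

-- weakening: shifts all free type variables (used for "X ∉ FTV(A)")
↑T : Ty → Ty
↑T = renT suc

extsT : (ℕ → Ty) → ℕ → Ty
extsT σ zero    = tv zero
extsT σ (suc n) = ↑T (σ n)

subT : (ℕ → Ty) → Ty → Ty
subT σ (tv n)  = σ n
subT σ (A ⇒ B) = subT σ A ⇒ subT σ B
subT σ (A ∧ B) = subT σ A ∧ subT σ B
subT σ (∀' A)  = ∀' (subT (extsT σ) A)

σT₀ : Ty → ℕ → Ty
σT₀ B zero    = B
σT₀ B (suc n) = tv n

_[_]T : Ty → Ty → Ty
A [ B ]T = subT (σT₀ B) A

infix 4 _≅_
data _≅_ : Ty → Ty → Set where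
  ≅-refl  : ∀ {A} → A ≅ A
  ≅-sym   : ∀ {A B} → A ≅ B → B ≅ A
  ≅-trans : ∀ {A B C} → A ≅ B → B ≅ C → A ≅ C
  ≅-⇒     : ∀ {A A' B B'} → A ≅ A' → B ≅ B' → (A ⇒ B) ≅ (A' ⇒ B')
  ≅-∧     : ∀ {A A' B B'} → A ≅ A' → B ≅ B' → (A ∧ B) ≅ (A' ∧ B')
  ≅-∀     : ∀ {A A'} → A ≅ A' → ∀' A ≅ ∀' A'
  comm    : ∀ {A B} → (A ∧ B) ≅ (B ∧ A)
  asso    : ∀ {A B C} → (A ∧ (B ∧ C)) ≅ ((A ∧ B) ∧ C)
  dist    : ∀ {A B C} → (A ⇒ (B ∧ C)) ≅ ((A ⇒ B) ∧ (A ⇒ C))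
  curry   : ∀ {A B C} → ((A ∧ B) ⇒ C) ≅ (A ⇒ B ⇒ C)
  p-comm  : ∀ {A B} → ∀' (↑T A ⇒ B) ≅ (A ⇒ ∀' B)     -- X ∉ FTV(A)
  p-dist  : ∀ {A B} → ∀' (A ∧ B) ≅ (∀' A ∧ ∀' B)

-- Terms (term variables as de Bruijn indices, typed by the context)

data Tm : Set where
  var  : ℕ → Tm
  lam  : Ty → Tm → Tm
  app  : Tm → Tm → Tm
  pair : Tm → Tm → Tm
  proj : Ty → Tm → Tm
  tlam : Tm → Tm
  tapp : Tm → Ty → Tm

subTT : (ℕ → Ty) → Tm → Tm
subTT σ (var n)    = var n
subTT σ (lam A r)  = lam (subT σ A) (subTT σ r)
subTT σ (app r s)  = app (subTT σ r) (subTT σ s)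
subTT σ (pair r s) = pair (subTT σ r) (subTT σ s)
subTT σ (proj A r) = proj (subT σ A) (subTT σ r)
subTT σ (tlam r)   = tlam (subTT (extsT σ) r)
subTT σ (tapp r A) = tapp (subTT σ r) (subT σ A)

↑TT : Tm → Tm
↑TT = subTT (λ n → tv (suc n))

_[_]TT : Tm → Ty → Tm
r [ A ]TT = subTT (σT₀ A) r

ren : (ℕ → ℕ) → Tm → Tm
ren ρ (var n)    = var (ρ n)
ren ρ (lam A r)  = lam A (ren (extR ρ) r)
ren ρ (app r s)  = app (ren ρ r) (ren ρ s)
ren ρ (pair r s) = pair (ren ρ r) (ren ρ s)
ren ρ (proj A r) = proj A (ren ρ r)
ren ρ (tlam r)   = tlam (ren ρ r)
ren ρ (tapp r A) = tapp (ren ρ r) A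

exts : (ℕ → Tm) → ℕ → Tm
exts σ zero    = var zero
exts σ (suc n) = ren suc (σ n)

sub : (ℕ → Tm) → Tm → Tm
sub σ (var n)    = σ n
sub σ (lam A r)  = lam A (sub (exts σ) r)
sub σ (app r s)  = app (sub σ r) (sub σ s)
sub σ (pair r s) = pair (sub σ r) (sub σ s)
sub σ (proj A r) = proj A (sub σ r)
sub σ (tlam r)   = tlam (sub (λ n → ↑TT (σ n)) r)
sub σ (tapp r A) = tapp (sub σ r) A

σ₀ : Tm → ℕ → Tm
σ₀ s zero    = s
σ₀ s (suc n) = var n

_[_] : Tm → Tm → Tm
r [ s ] = sub (σ₀ s) r

Ctx : Set
Ctx = List Ty

infix 4 _∋_∶_ _⊢_∶_
data _∋_∶_ : Ctx → ℕ → Ty → Set where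
  here  : ∀ {Γ A} → (A ∷ Γ) ∋ zero ∶ A
  there : ∀ {Γ A B n} → Γ ∋ n ∶ A → (B ∷ Γ) ∋ suc n ∶ A

data _⊢_∶_ (Γ : Ctx) : Tm → Ty → Set where
  ⊢var  : ∀ {n A} → Γ ∋ n ∶ A → Γ ⊢ var n ∶ A
  ⊢iso  : ∀ {r A B} → Γ ⊢ r ∶ A → A ≅ B → Γ ⊢ r ∶ B
  ⊢lam  : ∀ {r A B} → (A ∷ Γ) ⊢ r ∶ B → Γ ⊢ lam A r ∶ A ⇒ B
  ⊢app  : ∀ {r s A B} → Γ ⊢ r ∶ A ⇒ B → Γ ⊢ s ∶ A → Γ ⊢ app r s ∶ B
  ⊢pair : ∀ {r s A B} → Γ ⊢ r ∶ A → Γ ⊢ s ∶ B → Γ ⊢ pair r s ∶ A ∧ B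
  ⊢proj : ∀ {r A B} → Γ ⊢ r ∶ A ∧ B → Γ ⊢ proj A r ∶ A
  -- X ∉ FTV(Γ) is built in: the body is typed in the shifted context
  ⊢tlam : ∀ {r A} → map ↑T Γ ⊢ r ∶ A → Γ ⊢ tlam r ∶ ∀' A
  ⊢tapp : ∀ {r A B} → Γ ⊢ r ∶ ∀' A → Γ ⊢ tapp r B ∶ A [ B ]T

infix 4 _⊢_⇄_ _⊢_↪_ _⊢_⟶_
data _⊢_⇄_ (Γ : Ctx) : Tm → Tm → Set where
  ⇄-sym   : ∀ {r s} → Γ ⊢ r ⇄ s → Γ ⊢ s ⇄ r
  ⇄-lam   : ∀ {A r r'} → (A ∷ Γ) ⊢ r ⇄ r' → Γ ⊢ lam A r ⇄ lam A r'
  ⇄-appˡ  : ∀ {r r' s} → Γ ⊢ r ⇄ r' → Γ ⊢ app r s ⇄ app r' s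
  ⇄-appʳ  : ∀ {r s s'} → Γ ⊢ s ⇄ s' → Γ ⊢ app r s ⇄ app r s'
  ⇄-pairˡ : ∀ {r r' s} → Γ ⊢ r ⇄ r' → Γ ⊢ pair r s ⇄ pair r' s
  ⇄-pairʳ : ∀ {r s s'} → Γ ⊢ s ⇄ s' → Γ ⊢ pair r s ⇄ pair r s'
  ⇄-proj  : ∀ {A r r'} → Γ ⊢ r ⇄ r' → Γ ⊢ proj A r ⇄ proj A r'
  ⇄-tlam  : ∀ {r r'} → map ↑T Γ ⊢ r ⇄ r' → Γ ⊢ tlam r ⇄ tlam r'
  ⇄-tapp  : ∀ {A r r'} → Γ ⊢ r ⇄ r' → Γ ⊢ tapp r A ⇄ tapp r' A
  comm      : ∀ {r s} → Γ ⊢ pair r s ⇄ pair s r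
  asso      : ∀ {r s t} → Γ ⊢ pair r (pair s t) ⇄ pair (pair r s) t
  dist-λ    : ∀ {A r s} → Γ ⊢ lam A (pair r s) ⇄ pair (lam A r) (lam A s)
  dist-app  : ∀ {r s t} → Γ ⊢ app (pair r s) t ⇄ pair (app r t) (app s t)
  curry     : ∀ {r s t} → Γ ⊢ app r (pair s t) ⇄ app (app r s) t
  p-comm-λ  : ∀ {A r} → Γ ⊢ tlam (lam (↑T A) r) ⇄ lam A (tlam r)   -- X ∉ FTV(A)
  p-comm-ap : ∀ {A B r} → Γ ⊢ tapp (lam A r) B ⇄ lam A (tapp r B)
  p-dist-λ  : ∀ {r s} → Γ ⊢ tlam (pair r s) ⇄ pair (tlam r) (tlam s)
  p-dist-ap : ∀ {A r s} → Γ ⊢ tapp (pair r s) A ⇄ pair (tapp r A) (tapp s A)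
  p-dist-πλ : ∀ {A r} → Γ ⊢ proj (∀' A) (tlam r) ⇄ tlam (proj A r)
  p-dist-πap : ∀ {A B C r} → Γ ⊢ r ∶ ∀' (B ∧ C) →
              Γ ⊢ tapp (proj (∀' B) r) A ⇄ proj (B [ A ]T) (tapp r A)

data _⊢_↪_ (Γ : Ctx) : Tm → Tm → Set where
  β-λ   : ∀ {A r s} → Γ ⊢ s ∶ A → Γ ⊢ app (lam A r) s ↪ r [ s ]
  β-Λ   : ∀ {A r} → Γ ⊢ tapp (tlam r) A ↪ r [ A ]TT
  β-π   : ∀ {A r s} → Γ ⊢ r ∶ A → Γ ⊢ proj A (pair r s) ↪ r
  ↪-lam   : ∀ {A r r'} → (A ∷ Γ) ⊢ r ↪ r' → Γ ⊢ lam A r ↪ lam A r'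
  ↪-appˡ  : ∀ {r r' s} → Γ ⊢ r ↪ r' → Γ ⊢ app r s ↪ app r' s
  ↪-appʳ  : ∀ {r s s'} → Γ ⊢ s ↪ s' → Γ ⊢ app r s ↪ app r s'
  ↪-pairˡ : ∀ {r r' s} → Γ ⊢ r ↪ r' → Γ ⊢ pair r s ↪ pair r' s
  ↪-pairʳ : ∀ {r s s'} → Γ ⊢ s ↪ s' → Γ ⊢ pair r s ↪ pair r s'
  ↪-proj  : ∀ {A r r'} → Γ ⊢ r ↪ r' → Γ ⊢ proj A r ↪ proj A r'
  ↪-tlam  : ∀ {r r'} → map ↑T Γ ⊢ r ↪ r' → Γ ⊢ tlam r ↪ tlam r'
  ↪-tapp  : ∀ {A r r'} → Γ ⊢ r ↪ r' → Γ ⊢ tapp r A ↪ tapp r' A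

_⊢_⟶_ : Ctx → Tm → Tm → Set
Γ ⊢ r ⟶ r' = ∃[ r₁ ] ∃[ r₂ ]
  (Star (Γ ⊢_⇄_) r r₁ × Γ ⊢ r₁ ↪ r₂ × Star (Γ ⊢_⇄_) r₂ r')

SN : Ctx → Tm → Set
SN Γ r = (∃[ A ] Γ ⊢ r ∶ A) × Acc (λ t u → Γ ⊢ u ⟶ t) r

-- Elimination contexts  Elim Γ A B : hole of type A, context of type B

data Elim (Γ : Ctx) (A : Ty) : Ty → Set where
  hole  : Elim Γ A A
  eapp  : ∀ {B C} → Elim Γ A (B ⇒ C) → (s : Tm) → Γ ⊢ s ∶ B → SN Γ s → Elim Γ A C
  eproj : ∀ {B C} → Elim Γ A (B ∧ C) → Elim Γ A B
  etapp : ∀ {B} → Elim Γ A (∀' B) → (C : Ty) → Elim Γ A (B [ C ]T)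

plug : ∀ {Γ A B} → Elim Γ A B → Tm → Tm
plug hole t                 = t
plug (eapp K s _ _) t       = app (plug K t) s
plug (eproj {B = B} K) t    = proj B (plug K t)
plug (etapp K C) t          = tapp (plug K t) C

-- 𝒯(K) as a list (multiset)
𝒯 : ∀ {Γ A B} → Elim Γ A B → List Tm
𝒯 hole             = []
𝒯 (eapp K s _ _)   = s ∷ 𝒯 K
𝒯 (eproj K)        = 𝒯 K
𝒯 (etapp K _)      = 𝒯 K

data AllSN (Γ : Ctx) : List Tm → Set where
  []  : AllSN Γ []
  _∷_ : ∀ {s ss} → SN Γ s → AllSN Γ ss → AllSN Γ (s ∷ ss)

IsTyVar : Ty → Set
IsTyVar B = ∃[ n ] B ≡ tv n

⟦_⟧ : Ty → Ctx → Tm → Set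
⟦ A ⟧ Γ r = Γ ⊢ r ∶ A ×
  (∀ (Δ : Ctx) {B : Ty} (K : Elim (Γ ++ Δ) A B) →
     IsTyVar B → AllSN (Γ ++ Δ) (𝒯 K) → SN (Γ ++ Δ) (plug K r))

-- Eliminate A completely: apply it to fresh variables, take left projections
-- and instantiate each quantifier by a type variable, until the type is a
-- variable. Fresh variables are normal, so this elimination context K is
-- admissible and K[r] ∈ SN; since every step r ⟶ s yields a step
-- K[r] ⟶ K[s] in the extended context, r is strongly normalising as well.
module Submission where

open import Defs
open import Data.Nat using (ℕ; zero; suc)
open import Data.List using ([]; _∷_; map; _++_; length; [_])
open import Data.List.Properties using (map-++; ++-assoc)
open import Data.Product using (_,_; proj₂)
open import Data.Empty using (⊥; ⊥-elim)
open import Function using (_∘_; id)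
open import Relation.Binary.PropositionalEquality
  using (_≡_; refl; sym; trans; cong; cong₂; subst)
open import Relation.Binary.Construct.Closure.ReflexiveTransitive using (Star; ε; _◅_; gmap)
open import Induction.WellFounded using (Acc; acc; module Subrelation)
import Relation.Binary.Construct.On as On

private
  variable
    Γ : Ctx
    A B : Ty
    r s : Tm
    n : ℕ

∋-weaken : (Δ : Ctx) → Γ ∋ n ∶ A → (Γ ++ Δ) ∋ n ∶ A
∋-weaken Δ here      = here
∋-weaken Δ (there x) = there (∋-weaken Δ x)

⊢-weaken : (Δ : Ctx) → Γ ⊢ r ∶ A → (Γ ++ Δ) ⊢ r ∶ A
⊢-weaken Δ (⊢var x)    = ⊢var (∋-weaken Δ x)
⊢-weaken Δ (⊢iso d e)  = ⊢iso (⊢-weaken Δ d) e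
⊢-weaken Δ (⊢lam d)    = ⊢lam (⊢-weaken Δ d)
⊢-weaken Δ (⊢app d e)  = ⊢app (⊢-weaken Δ d) (⊢-weaken Δ e)
⊢-weaken Δ (⊢pair d e) = ⊢pair (⊢-weaken Δ d) (⊢-weaken Δ e)
⊢-weaken Δ (⊢proj d)   = ⊢proj (⊢-weaken Δ d)
⊢-weaken {Γ} Δ (⊢tlam {r} {A} d) =
  ⊢tlam (subst (_⊢ r ∶ A) (sym (map-++ ↑T Γ Δ)) (⊢-weaken (map ↑T Δ) d))
⊢-weaken Δ (⊢tapp d)   = ⊢tapp (⊢-weaken Δ d)

⇄-weaken : (Δ : Ctx) → Γ ⊢ r ⇄ s → (Γ ++ Δ) ⊢ r ⇄ s
⇄-weaken Δ (⇄-sym p)   = ⇄-sym (⇄-weaken Δ p)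
⇄-weaken Δ (⇄-lam p)   = ⇄-lam (⇄-weaken Δ p)
⇄-weaken Δ (⇄-appˡ p)  = ⇄-appˡ (⇄-weaken Δ p)
⇄-weaken Δ (⇄-appʳ p)  = ⇄-appʳ (⇄-weaken Δ p)
⇄-weaken Δ (⇄-pairˡ p) = ⇄-pairˡ (⇄-weaken Δ p)
⇄-weaken Δ (⇄-pairʳ p) = ⇄-pairʳ (⇄-weaken Δ p)
⇄-weaken Δ (⇄-proj p)  = ⇄-proj (⇄-weaken Δ p)
⇄-weaken {Γ} Δ (⇄-tlam {r} {r'} p) =
  ⇄-tlam (subst (_⊢ r ⇄ r') (sym (map-++ ↑T Γ Δ)) (⇄-weaken (map ↑T Δ) p))
⇄-weaken Δ (⇄-tapp p)  = ⇄-tapp (⇄-weaken Δ p)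
⇄-weaken Δ comm           = comm
⇄-weaken Δ asso           = asso
⇄-weaken Δ dist-λ         = dist-λ
⇄-weaken Δ dist-app       = dist-app
⇄-weaken Δ curry          = curry
⇄-weaken Δ p-comm-λ       = p-comm-λ
⇄-weaken Δ p-comm-ap      = p-comm-ap
⇄-weaken Δ p-dist-λ       = p-dist-λ
⇄-weaken Δ p-dist-ap      = p-dist-ap
⇄-weaken Δ p-dist-πλ      = p-dist-πλ
⇄-weaken Δ (p-dist-πap d) = p-dist-πap (⊢-weaken Δ d)

↪-weaken : (Δ : Ctx) → Γ ⊢ r ↪ s → (Γ ++ Δ) ⊢ r ↪ s
↪-weaken Δ (β-λ d)     = β-λ (⊢-weaken Δ d)
↪-weaken Δ β-Λ         = β-Λ
↪-weaken Δ (β-π d)     = β-π (⊢-weaken Δ d)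
↪-weaken Δ (↪-lam p)   = ↪-lam (↪-weaken Δ p)
↪-weaken Δ (↪-appˡ p)  = ↪-appˡ (↪-weaken Δ p)
↪-weaken Δ (↪-appʳ p)  = ↪-appʳ (↪-weaken Δ p)
↪-weaken Δ (↪-pairˡ p) = ↪-pairˡ (↪-weaken Δ p)
↪-weaken Δ (↪-pairʳ p) = ↪-pairʳ (↪-weaken Δ p)
↪-weaken Δ (↪-proj p)  = ↪-proj (↪-weaken Δ p)
↪-weaken {Γ} Δ (↪-tlam {r} {r'} p) =
  ↪-tlam (subst (_⊢ r ↪ r') (sym (map-++ ↑T Γ Δ)) (↪-weaken (map ↑T Δ) p))
↪-weaken Δ (↪-tapp p)  = ↪-tapp (↪-weaken Δ p)

plug-⇄ : (K : Elim Γ A B) → Γ ⊢ r ⇄ s → Γ ⊢ plug K r ⇄ plug K s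
plug-⇄ hole           p = p
plug-⇄ (eapp K _ _ _) p = ⇄-appˡ (plug-⇄ K p)
plug-⇄ (eproj K)      p = ⇄-proj (plug-⇄ K p)
plug-⇄ (etapp K _)    p = ⇄-tapp (plug-⇄ K p)

plug-↪ : (K : Elim Γ A B) → Γ ⊢ r ↪ s → Γ ⊢ plug K r ↪ plug K s
plug-↪ hole           p = p
plug-↪ (eapp K _ _ _) p = ↪-appˡ (plug-↪ K p)
plug-↪ (eproj K)      p = ↪-proj (plug-↪ K p)
plug-↪ (etapp K _)    p = ↪-tapp (plug-↪ K p)

plug-weaken-⟶ : (Δ : Ctx) (K : Elim (Γ ++ Δ) A B) →
                Γ ⊢ r ⟶ s → (Γ ++ Δ) ⊢ plug K r ⟶ plug K s
plug-weaken-⟶ Δ K (r₁ , r₂ , r⇄r₁ , r₁↪r₂ , r₂⇄s) =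
  plug K r₁ , plug K r₂ , lift r⇄r₁ , plug-↪ K (↪-weaken Δ r₁↪r₂) , lift r₂⇄s
  where
  lift : ∀ {t u} → Star (_ ⊢_⇄_) t u → Star (_ ⊢_⇄_) (plug K t) (plug K u)
  lift = gmap (plug K) (plug-⇄ K ∘ ⇄-weaken Δ)

Acc-unplug : (Δ : Ctx) (K : Elim (Γ ++ Δ) A B) →
             Acc (λ t u → (Γ ++ Δ) ⊢ u ⟶ t) (plug K r) →
             Acc (λ t u → Γ ⊢ u ⟶ t) r
Acc-unplug Δ K =
  Subrelation.accessible (plug-weaken-⟶ Δ K) ∘ On.accessible (plug K)

var-⇄-⊥ : Γ ⊢ var n ⇄ s → ⊥
⇄-var-⊥ : Γ ⊢ s ⇄ var n → ⊥
var-⇄-⊥ (⇄-sym p) = ⇄-var-⊥ p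
⇄-var-⊥ (⇄-sym p) = var-⇄-⊥ p

var-↪-⊥ : Γ ⊢ var n ↪ s → ⊥
var-↪-⊥ ()

SN-var : Γ ⊢ var n ∶ A → SN Γ (var n)
SN-var ⊢x = (_ , ⊢x) , acc λ where
  (_ , _ , ε     , x↪ , _) → ⊥-elim (var-↪-⊥ x↪)
  (_ , _ , x⇄ ◅ _ , _  , _) → ⊥-elim (var-⇄-⊥ x⇄)

∋-length : (P Q : Ctx) → (P ++ A ∷ Q) ∋ length P ∶ A
∋-length []      Q = here
∋-length (_ ∷ P) Q = there (∋-length P Q)

subT-cong : ∀ {σ τ} → (∀ n → σ n ≡ τ n) → ∀ A → subT σ A ≡ subT τ A
subT-cong σ≗τ (tv n)  = σ≗τ n
subT-cong σ≗τ (A ⇒ B) = cong₂ _⇒_ (subT-cong σ≗τ A) (subT-cong σ≗τ B)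
subT-cong σ≗τ (A ∧ B) = cong₂ _∧_ (subT-cong σ≗τ A) (subT-cong σ≗τ B)
subT-cong σ≗τ (∀' A)  = cong ∀' (subT-cong extsT-cong A)
  where
  extsT-cong : ∀ n → extsT _ n ≡ extsT _ n
  extsT-cong zero    = refl
  extsT-cong (suc n) = cong ↑T (σ≗τ n)

subT-renT : ∀ σ ρ A → subT σ (renT ρ A) ≡ subT (σ ∘ ρ) A
subT-renT σ ρ (tv n)  = refl
subT-renT σ ρ (A ⇒ B) = cong₂ _⇒_ (subT-renT σ ρ A) (subT-renT σ ρ B)
subT-renT σ ρ (A ∧ B) = cong₂ _∧_ (subT-renT σ ρ A) (subT-renT σ ρ B)
subT-renT σ ρ (∀' A)  =
  cong ∀' (trans (subT-renT (extsT σ) (extR ρ) A) (subT-cong extsT-extR A))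
  where
  extsT-extR : ∀ n → extsT σ (extR ρ n) ≡ extsT (σ ∘ ρ) n
  extsT-extR zero    = refl
  extsT-extR (suc n) = refl

subT-tv : ∀ ρ A → subT (tv ∘ ρ) A ≡ renT ρ A
subT-tv ρ (tv n)  = refl
subT-tv ρ (A ⇒ B) = cong₂ _⇒_ (subT-tv ρ A) (subT-tv ρ B)
subT-tv ρ (A ∧ B) = cong₂ _∧_ (subT-tv ρ A) (subT-tv ρ B)
subT-tv ρ (∀' A)  = cong ∀' (trans (subT-cong extsT-tv A) (subT-tv (extR ρ) A))
  where
  extsT-tv : ∀ n → extsT (tv ∘ ρ) n ≡ tv (extR ρ n)
  extsT-tv zero    = refl
  extsT-tv (suc n) = refl

renT-id : ∀ {ρ} → (∀ n → ρ n ≡ n) → ∀ A → renT ρ A ≡ A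
renT-id ρ≗id (tv n)  = cong tv (ρ≗id n)
renT-id ρ≗id (A ⇒ B) = cong₂ _⇒_ (renT-id ρ≗id A) (renT-id ρ≗id B)
renT-id ρ≗id (A ∧ B) = cong₂ _∧_ (renT-id ρ≗id A) (renT-id ρ≗id B)
renT-id ρ≗id (∀' A)  = cong ∀' (renT-id extR-id A)
  where
  extR-id : ∀ n → extR _ n ≡ n
  extR-id zero    = refl
  extR-id (suc n) = cong suc (ρ≗id n)

-- Instantiating the bound variable by tv 0 merges it with the free variable 0.
mergeR : (ℕ → ℕ) → ℕ → ℕ
mergeR ρ zero    = zero
mergeR ρ (suc n) = ρ n

renT-extR-[tv0] : ∀ ρ B → renT (extR ρ) B [ tv zero ]T ≡ renT (mergeR ρ) B
renT-extR-[tv0] ρ B =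
  trans (subT-renT (σT₀ (tv zero)) (extR ρ) B)
        (trans (subT-cong σT₀-extR B) (subT-tv (mergeR ρ) B))
  where
  σT₀-extR : ∀ n → σT₀ (tv zero) (extR ρ n) ≡ tv (mergeR ρ n)
  σT₀-extR zero    = refl
  σT₀-extR (suc n) = refl

record AdmissibleElim (Γ : Ctx) (A : Ty) : Set where
  field
    {target} : Ty
    elim     : Elim Γ A target
    isTyVar  : IsTyVar target
    allSN    : AllSN Γ (𝒯 elim)

spineArgs : (ℕ → ℕ) → Ty → Ctx
spineArgs ρ (tv n)  = []
spineArgs ρ (B ⇒ C) = renT ρ B ∷ spineArgs ρ C
spineArgs ρ (B ∧ C) = spineArgs ρ B
spineArgs ρ (∀' B)  = spineArgs (mergeR ρ) B

-- The arguments still to be supplied are the variables of the suffix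
-- spineArgs ρ B of Γ', i.e. those from position length P on.
extendSpine : ∀ {Γ' A T} (B : Ty) (ρ : ℕ → ℕ) (P : Ctx) → Γ' ≡ P ++ spineArgs ρ B →
              (K : Elim Γ' A T) → T ≡ renT ρ B → AllSN Γ' (𝒯 K) →
              AdmissibleElim Γ' A
extendSpine (tv n) ρ P _ K T≡ρn SN-𝒯K = record
  { elim = K ; isTyVar = ρ n , T≡ρn ; allSN = SN-𝒯K }
extendSpine {Γ'} (B ⇒ C) ρ P Γ'≡ K refl SN-𝒯K =
  extendSpine C ρ (P ++ [ renT ρ B ]) Γ'≡′ (eapp K x ⊢x (SN-var ⊢x)) refl
    (SN-var ⊢x ∷ SN-𝒯K)
  where
  x : Tm
  x = var (length P)
  ⊢x : Γ' ⊢ x ∶ renT ρ B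
  ⊢x = ⊢var (subst (_∋ length P ∶ renT ρ B) (sym Γ'≡) (∋-length P _))
  Γ'≡′ : Γ' ≡ (P ++ [ renT ρ B ]) ++ spineArgs ρ C
  Γ'≡′ = trans Γ'≡ (sym (++-assoc P [ renT ρ B ] (spineArgs ρ C)))
extendSpine (B ∧ C) ρ P Γ'≡ K refl SN-𝒯K =
  extendSpine B ρ P Γ'≡ (eproj K) refl SN-𝒯K
extendSpine (∀' B) ρ P Γ'≡ K refl SN-𝒯K =
  extendSpine B (mergeR ρ) P Γ'≡ (etapp K (tv zero)) (renT-extR-[tv0] ρ B) SN-𝒯K

spine : ∀ Γ A → AdmissibleElim (Γ ++ spineArgs id A) A
spine Γ A = extendSpine A id Γ refl hole (sym (renT-id (λ _ → refl) A)) []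

mainTheorem15 : (Γ : Ctx) (A : Ty) (r : Tm) → ⟦ A ⟧ Γ r → SN Γ r
mainTheorem15 Γ A r (⊢r , reducible) =
  (A , ⊢r) , Acc-unplug Δ elim (proj₂ (reducible Δ elim isTyVar allSN))
  where
  Δ : Ctx
  Δ = spineArgs id A
  open AdmissibleElim (spine Γ A)
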